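{- Let $n\ge1$, $C\in DC(n)$ and $p,q\in[2n]$ with $p<q$. Then the pair of dots $(e_p,e_q)$ is an inversion of $C$ if and only if $\tau_C(p)>\tau_C(q)$.
   Context: A Dellac configuration of size $n$ is a placement of $2n$ dots in a grid with $n$ columns (indexed $1..n$ left to right) and $2n$ rows (indexed $1..2n$ bottom to top) such that each row has exactly one dot, each column exactly two dots, and each dot in column $j$, row $i$ satisfies $j\le i\le j+n$; $DC(n)$ is their set. An inversion of $C$ is a pair of dots with (column,row) coordinates $(j_1,i_1),(j_2,i_2)$, $j_1<j_2$, $i_1>i_2$. The dot in row $i\le n$ is labeled $e_i=2i+2$ and the dot in row $n+i$ ($i\in[n]$) is labeled $e_{n+i}=2i-1$. For $j\in[n]$, $i_1(j)<i_2(j)$ are the row indices of the two dots in column $j$. $\phi(C)\in\mathfrak{S}_{2n+2}$ is defined by $\phi(C)^{ -1}(1)=2$, $\phi(C)^{ -1}(2j)=e_{i_2(j)}$, $\phi(C)^{ -1}(2j+1)=e_{i_1(j)}$ for $j\in[n]$, $\phi(C)^{ -1}(2n+2)=2n+1$. Let $y_{2m-1}=2m+1$, $y_{2m}=2m$ for $m\in[n]$. The permutation $\tau_C\in\mathfrak{S}_{2n}$ is defined by $\phi(C)(e_i)=y_{\tau_C(i)}$ for all $i\in[2n]$. -}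

module Defs where

open import Data.Nat using (ℕ; zero; suc; _+_; _*_; _∸_; _≤_; _<_; _≟_; _≡ᵇ_; _/_; _%_; _≤ᵇ_)
open import Data.Bool using (Bool; true; false; if_then_else_)
open import Data.List using (List; []; _∷_; map; filter; length; upTo)
open import Data.Product using (_×_)
open import Data.Sum using (_⊎_)
open import Relation.Binary.PropositionalEquality using (_≡_)

-- A configuration is encoded by the function  col : ℕ → ℕ  sending a row
-- index i ∈ [1,2n] to the column index of the (unique) dot in row i.
-- (Each row has exactly one dot, so this is a complete description.)

rows : ℕ → List ℕ
rows n = map suc (upTo (2 * n))

rowsIn : ℕ → (ℕ → ℕ) → ℕ → List ℕ
rowsIn n col j = filter (λ i → col i ≟ j) (rows n)

IsDellac : ℕ → (ℕ → ℕ) → Set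
IsDellac n col =
  (∀ i → 1 ≤ i → i ≤ 2 * n →
     (1 ≤ col i) × (col i ≤ n) × (col i ≤ i) × (i ≤ col i + n))
  × (∀ j → 1 ≤ j → j ≤ n → length (rowsIn n col j) ≡ 2)

-- An ordered inversion: dot in row a is strictly left of the dot in row b
-- and strictly higher.
Inv : (ℕ → ℕ) → ℕ → ℕ → Set
Inv col a b = (col a < col b) × (b < a)

IsInversion : (ℕ → ℕ) → ℕ → ℕ → Set
IsInversion col a b = Inv col a b ⊎ Inv col b a

e : ℕ → ℕ → ℕ
e n i = if i ≤ᵇ n then 2 * i + 2 else 2 * (i ∸ n) ∸ 1

first second : List ℕ → ℕ
first (x ∷ _) = x
first [] = 0
second (_ ∷ y ∷ _) = y
second _ = 0

i₁ i₂ : ℕ → (ℕ → ℕ) → ℕ → ℕ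
i₁ n col j = first (rowsIn n col j)
i₂ n col j = second (rowsIn n col j)

φinv : ℕ → (ℕ → ℕ) → ℕ → ℕ
φinv n col k =
  if k ≡ᵇ 1 then 2
  else if k ≡ᵇ (2 * n + 2) then 2 * n + 1
  else if (k % 2) ≡ᵇ 0 then e n (i₂ n col (k / 2))
  else e n (i₁ n col (k / 2))

y : ℕ → ℕ
y m = if (m % 2) ≡ᵇ 0 then m else m + 2

module Submission where

-- Write j = col i for the column of the dot in row i.  Since
-- φ(C)⁻¹(2j) = e_{i₂(j)} and φ(C)⁻¹(2j+1) = e_{i₁(j)}, the defining relation
-- φ(C)(e_i) = y_{τ_C(i)} gives y_{τ_C(i)} = 2j if the dot is the upper dot of
-- its column and y_{τ_C(i)} = 2j+1 if it is the lower one; inverting y yields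
--     τ_C(i) = 2j      (upper dot),        τ_C(i) = 2j - 1   (lower dot).
-- Hence τ_C lists the dots column by column, bottom dot first.  For p < q this
-- means: if col q < col p then τ_C(q) < τ_C(p); if col p = col q then p is the
-- lower and q the upper dot, so τ_C(p) < τ_C(q).  As p < q, the pair is an
-- inversion exactly when col q < col p, which is therefore equivalent to
-- τ_C(q) < τ_C(p).

open import Defs
open import Data.Nat using (ℕ; _+_; _*_; _≤_; _<_)
open import Data.Product using (_×_)
open import Function.Bundles using (_⇔_)
open import Relation.Binary.PropositionalEquality using (_≡_)

open import Data.Nat using (suc; _≟_; _≡ᵇ_; _%_; _/_; z≤n; s≤s)
open import Data.Nat.Properties
open import Data.Nat.DivMod using (m*n%n≡0; m*n/n≡m; [m+kn]%n≡m%n; +-distrib-/-∣ʳ)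
open import Data.Nat.Divisibility using (divides-refl)
open import Data.Bool using (true; false; T; if_then_else_)
open import Data.Unit using (tt)
open import Data.List using (List; []; _∷_; length)
open import Data.List.Relation.Unary.AllPairs using (AllPairs; _∷_)
import Data.List.Relation.Unary.AllPairs.Properties as AllPairs
open import Data.List.Relation.Unary.All using (_∷_)
open import Data.List.Membership.Propositional using (_∈_)
open import Data.List.Membership.Propositional.Properties
  using (∈-map⁺; ∈-map⁻; ∈-upTo⁺; ∈-upTo⁻; ∈-filter⁺; ∈-filter⁻)
open import Data.List.Relation.Unary.Any using (here; there)
open import Data.Product using (_,_; proj₁; proj₂; Σ-syntax)
open import Data.Sum using (_⊎_; inj₁; inj₂)
open import Function using (id; _on_)
open import Function.Bundles using (mk⇔)
open import Relation.Binary.Definitions using (tri<; tri≈; tri>)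
open import Relation.Nullary using (contradiction)
open import Relation.Binary.PropositionalEquality using (_≢_; refl; sym; trans; cong; subst; module ≡-Reasoning)

≢⇒≡ᵇ-false : ∀ {m k} → m ≢ k → (m ≡ᵇ k) ≡ false
≢⇒≡ᵇ-false {m} {k} m≢k with m ≡ᵇ k in eq
... | false = refl
... | true  = contradiction (≡ᵇ⇒≡ m k (subst T (sym eq) tt)) m≢k

-- 2j and 2j+1 lie in [2, 2n+1] for j ∈ [1,n], so they avoid the two special
-- arguments 1 and 2n+2 of φ⁻¹ and are admissible arguments of φ ∘ φ⁻¹ = id.
double+1<top : ∀ {n j} → j ≤ n → suc (j * 2) < 2 * n + 2
double+1<top {n} {j} j≤n = begin-strict
  suc (j * 2) ≤⟨ s≤s (*-monoˡ-≤ 2 j≤n) ⟩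
  suc (n * 2) ≡⟨ cong suc (*-comm n 2) ⟩
  suc (2 * n) ≡⟨ +-comm 1 (2 * n) ⟩
  2 * n + 1   <⟨ +-monoʳ-< (2 * n) (n<1+n 1) ⟩
  2 * n + 2   ∎
  where open ≤-Reasoning

double-≢-top : ∀ {n j} → j ≤ n → j * 2 ≢ 2 * n + 2
double-≢-top j≤n = <⇒≢ (<-trans (n<1+n _) (double+1<top j≤n))

double+1-≢-top : ∀ {n j} → j ≤ n → suc (j * 2) ≢ 2 * n + 2
double+1-≢-top {n} {j} j≤n eq = even≢odd (suc n) j (begin
  2 * suc n   ≡⟨ *-suc 2 n ⟩
  2 + 2 * n   ≡⟨ +-comm 2 (2 * n) ⟩
  2 * n + 2   ≡⟨ sym eq ⟩
  suc (j * 2) ≡⟨ cong suc (*-comm j 2) ⟩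
  suc (2 * j) ∎)
  where open ≡-Reasoning

φinv-middle : ∀ n col k {b} → k ≢ 1 → k ≢ 2 * n + 2 → ((k % 2) ≡ᵇ 0) ≡ b →
              φinv n col k ≡ (if b then e n (i₂ n col (k / 2)) else e n (i₁ n col (k / 2)))
φinv-middle n col k k≢1 k≢top refl
  rewrite ≢⇒≡ᵇ-false k≢1 | ≢⇒≡ᵇ-false k≢top = refl

φinv-even : ∀ n col j → 1 ≤ j → j ≤ n → φinv n col (j * 2) ≡ e n (i₂ n col j)
φinv-even n col j@(suc _) _ j≤n = begin
  φinv n col (j * 2)          ≡⟨ φinv-middle n col (j * 2) (λ ()) (double-≢-top j≤n)
                                   (cong (_≡ᵇ 0) (m*n%n≡0 j 2)) ⟩
  e n (i₂ n col (j * 2 / 2))  ≡⟨ cong (λ k → e n (i₂ n col k)) (m*n/n≡m j 2) ⟩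
  e n (i₂ n col j)            ∎
  where open ≡-Reasoning

φinv-odd : ∀ n col j → 1 ≤ j → j ≤ n → φinv n col (suc (j * 2)) ≡ e n (i₁ n col j)
φinv-odd n col j@(suc _) _ j≤n = begin
  φinv n col (suc (j * 2))          ≡⟨ φinv-middle n col (suc (j * 2)) (λ ()) (double+1-≢-top j≤n)
                                         (cong (_≡ᵇ 0) ([m+kn]%n≡m%n 1 j 2)) ⟩
  e n (i₁ n col (suc (j * 2) / 2))  ≡⟨ cong (λ k → e n (i₁ n col k)) half ⟩
  e n (i₁ n col j)                  ∎
  where
  open ≡-Reasoning
  half : suc (j * 2) / 2 ≡ j
  half = trans (+-distrib-/-∣ʳ 1 {d = 2} (divides-refl j)) (m*n/n≡m j 2)

y-even : ∀ m j → y m ≡ j * 2 → m ≡ j * 2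
y-even m j eq with (m % 2) ≡ᵇ 0 in parity
... | true  = eq
... | false = contradiction (≡⇒≡ᵇ (m % 2) 0 m-even) (subst T parity)
  where
  m-even : m % 2 ≡ 0
  m-even = begin
    m % 2           ≡⟨ sym ([m+kn]%n≡m%n m 1 2) ⟩
    (m + 2) % 2     ≡⟨ cong (_% 2) eq ⟩
    (j * 2) % 2     ≡⟨ m*n%n≡0 j 2 ⟩
    0               ∎
    where open ≡-Reasoning

y-odd : ∀ m j → y m ≡ suc (j * 2) → suc m ≡ j * 2
y-odd m j eq with (m % 2) ≡ᵇ 0 in parity
... | true  = contradiction m-odd λ ()
  where
  m-odd : 1 ≡ 0
  m-odd = begin
    1                   ≡⟨ sym ([m+kn]%n≡m%n 1 j 2) ⟩
    suc (j * 2) % 2     ≡⟨ cong (_% 2) (sym eq) ⟩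
    m % 2               ≡⟨ ≡ᵇ⇒≡ (m % 2) 0 (subst T (sym parity) tt) ⟩
    0                   ∎
    where open ≡-Reasoning
... | false = suc-injective (trans (+-comm 2 m) eq)

rowsIn-sorted : ∀ n col j → AllPairs _<_ (rowsIn n col j)
rowsIn-sorted n col j = AllPairs.filter⁺ (λ i → col i ≟ j)
  (AllPairs.map⁺ (AllPairs.applyUpTo⁺₁ {R = _<_ on suc} id (2 * n) (λ i<k _ → s≤s i<k)))

sorted-pair : ∀ (xs : List ℕ) → length xs ≡ 2 → AllPairs _<_ xs →
              Σ[ a ∈ ℕ ] Σ[ b ∈ ℕ ] (xs ≡ a ∷ b ∷ []) × (a < b)
sorted-pair (a ∷ b ∷ []) refl ((a<b ∷ _) ∷ _) = a , b , refl , a<b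

column-pair : ∀ n col → IsDellac n col → ∀ j → 1 ≤ j → j ≤ n →
              Σ[ a ∈ ℕ ] Σ[ b ∈ ℕ ] (rowsIn n col j ≡ a ∷ b ∷ []) × (a < b)
column-pair n col (_ , twoDots) j 1≤j j≤n =
  sorted-pair (rowsIn n col j) (twoDots j 1≤j j≤n) (rowsIn-sorted n col j)

row-in-own-column : ∀ n col i → 1 ≤ i → i ≤ 2 * n → i ∈ rowsIn n col (col i)
row-in-own-column n col i@(suc _) _ i≤2n =
  ∈-filter⁺ (λ k → col k ≟ col i) (∈-map⁺ suc (∈-upTo⁺ i≤2n)) refl

rowsIn-range : ∀ n col j {x} → x ∈ rowsIn n col j → 1 ≤ x × x ≤ 2 * n
rowsIn-range n col j x∈
  with ∈-map⁻ suc (proj₁ (∈-filter⁻ (λ i → col i ≟ j) {xs = rows n} x∈))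
... | _ , k∈ , refl = s≤s z≤n , ∈-upTo⁻ k∈

∈-pair : ∀ {x a b : ℕ} → x ∈ a ∷ b ∷ [] → (x ≡ a) ⊎ (x ≡ b)
∈-pair (here x≡a)         = inj₁ x≡a
∈-pair (there (here x≡b)) = inj₂ x≡b

ordered-in-pair : ∀ {x z a b : ℕ} → x ∈ a ∷ b ∷ [] → z ∈ a ∷ b ∷ [] → a < b → x < z →
                  (x ≡ a) × (z ≡ b)
ordered-in-pair x∈ z∈ a<b x<z with ∈-pair x∈ | ∈-pair z∈
... | inj₁ refl | inj₁ refl = contradiction x<z (<-irrefl refl)
... | inj₁ refl | inj₂ refl = refl , refl
... | inj₂ refl | inj₁ refl = contradiction x<z (<-asym a<b)
... | inj₂ refl | inj₂ refl = contradiction x<z (<-irrefl refl)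

module Labelling (n : ℕ) (col : ℕ → ℕ) (D : IsDellac n col) (φ τ : ℕ → ℕ)
  (hφ : ∀ k → 1 ≤ k → k ≤ 2 * n + 2 → φ (φinv n col k) ≡ k)
  (hτ : ∀ i → 1 ≤ i → i ≤ 2 * n →
          (1 ≤ τ i) × (τ i ≤ 2 * n) × (φ (e n i) ≡ y (τ i))) where

  φ-e : ∀ i → 1 ≤ i → i ≤ 2 * n → φ (e n i) ≡ y (τ i)
  φ-e i 1≤i i≤2n = proj₂ (proj₂ (hτ i 1≤i i≤2n))

  τ-upper : ∀ i j → 1 ≤ i → i ≤ 2 * n → 1 ≤ j → j ≤ n → i ≡ i₂ n col j → τ i ≡ j * 2
  τ-upper i j 1≤i i≤2n 1≤j j≤n refl = y-even (τ i) j (begin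
    y (τ i)                    ≡⟨ sym (φ-e i 1≤i i≤2n) ⟩
    φ (e n (i₂ n col j))       ≡⟨ cong φ (sym (φinv-even n col j 1≤j j≤n)) ⟩
    φ (φinv n col (j * 2))     ≡⟨ hφ (j * 2) (≤-trans 1≤j (m≤m*n j 2))
                                    (≤-trans (n≤1+n _) (<⇒≤ (double+1<top j≤n))) ⟩
    j * 2                      ∎)
    where open ≡-Reasoning

  τ-lower : ∀ i j → 1 ≤ i → i ≤ 2 * n → 1 ≤ j → j ≤ n → i ≡ i₁ n col j → suc (τ i) ≡ j * 2
  τ-lower i j 1≤i i≤2n 1≤j j≤n refl = y-odd (τ i) j (begin
    y (τ i)                      ≡⟨ sym (φ-e i 1≤i i≤2n) ⟩
    φ (e n (i₁ n col j))         ≡⟨ cong φ (sym (φinv-odd n col j 1≤j j≤n)) ⟩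
    φ (φinv n col (suc (j * 2))) ≡⟨ hφ (suc (j * 2)) (s≤s z≤n) (<⇒≤ (double+1<top j≤n)) ⟩
    suc (j * 2)                  ∎)
    where open ≡-Reasoning

  column-bounds : ∀ i → 1 ≤ i → i ≤ 2 * n → 1 ≤ col i × col i ≤ n
  column-bounds i 1≤i i≤2n with proj₁ D i 1≤i i≤2n
  ... | 1≤j , j≤n , _ = 1≤j , j≤n

  column-τ : ∀ j → 1 ≤ j → j ≤ n →
             Σ[ a ∈ ℕ ] Σ[ b ∈ ℕ ] (rowsIn n col j ≡ a ∷ b ∷ []) × (a < b) ×
               (suc (τ a) ≡ j * 2) × (τ b ≡ j * 2)
  column-τ j 1≤j j≤n with column-pair n col D j 1≤j j≤n
  ... | a , b , shape , a<b with rowsIn-range n col j (member (here refl))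
                               | rowsIn-range n col j (member (there (here refl)))
    where
    member : ∀ {x} → x ∈ a ∷ b ∷ [] → x ∈ rowsIn n col j
    member = subst (_ ∈_) (sym shape)
  ... | 1≤a , a≤2n | 1≤b , b≤2n =
    a , b , shape , a<b ,
    τ-lower a j 1≤a a≤2n 1≤j j≤n (cong first (sym shape)) ,
    τ-upper b j 1≤b b≤2n 1≤j j≤n (cong second (sym shape))

  τ-near-column : ∀ i → 1 ≤ i → i ≤ 2 * n → τ i ≤ col i * 2 × col i * 2 ≤ suc (τ i)
  τ-near-column i 1≤i i≤2n with column-bounds i 1≤i i≤2n
  ... | 1≤j , j≤n with column-τ (col i) 1≤j j≤n
  ... | a , b , shape , _ , τa , τb
        with ∈-pair (subst (i ∈_) shape (row-in-own-column n col i 1≤i i≤2n))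
  ... | inj₁ refl = ≤-trans (n≤1+n _) (≤-reflexive τa) , ≤-reflexive (sym τa)
  ... | inj₂ refl = ≤-reflexive τb , ≤-trans (≤-reflexive (sym τb)) (n≤1+n _)

  τ-column-monotone : ∀ p q → 1 ≤ p → p ≤ 2 * n → 1 ≤ q → q ≤ 2 * n →
                      col q < col p → τ q < τ p
  τ-column-monotone p q 1≤p p≤2n 1≤q q≤2n cq<cp
    with τ-near-column p 1≤p p≤2n | τ-near-column q 1≤q q≤2n
  ... | _ , low-p | up-q , _ = ≤-pred (begin
    suc (suc (τ q))     ≤⟨ s≤s (s≤s up-q) ⟩
    suc (col q) * 2     ≤⟨ *-monoˡ-≤ 2 cq<cp ⟩
    col p * 2           ≤⟨ low-p ⟩
    suc (τ p)           ∎)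
    where open ≤-Reasoning

  τ-within-column : ∀ p q → 1 ≤ p → p ≤ 2 * n → 1 ≤ q → q ≤ 2 * n →
                    p < q → col p ≡ col q → τ p < τ q
  τ-within-column p q 1≤p p≤2n 1≤q q≤2n p<q cp≡cq with column-bounds q 1≤q q≤2n
  ... | 1≤j , j≤n with column-τ (col q) 1≤j j≤n
  ... | a , b , shape , a<b , τa , τb with ordered-in-pair p∈ q∈ a<b p<q
    where
    p∈ : p ∈ a ∷ b ∷ []
    p∈ = subst (p ∈_) (trans (cong (rowsIn n col) cp≡cq) shape) (row-in-own-column n col p 1≤p p≤2n)
    q∈ : q ∈ a ∷ b ∷ []
    q∈ = subst (q ∈_) shape (row-in-own-column n col q 1≤q q≤2n)
  ... | refl , refl = ≤-reflexive (trans τa (sym τb))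

lemma1 : (n : ℕ) → 1 ≤ n → (col : ℕ → ℕ) → IsDellac n col →
    (φ τ : ℕ → ℕ) →
    (∀ k → 1 ≤ k → k ≤ 2 * n + 2 → φ (φinv n col k) ≡ k) →
    (∀ i → 1 ≤ i → i ≤ 2 * n →
    (1 ≤ τ i) × (τ i ≤ 2 * n) × (φ (e n i) ≡ y (τ i))) →
    ∀ p q → 1 ≤ p → p < q → q ≤ 2 * n →
    (IsInversion col p q ⇔ τ q < τ p)
lemma1 n _ col D φ τ hφ hτ p q 1≤p p<q q≤2n = mk⇔ inversion⇒τ-reversed τ-reversed⇒inversion
  where
  open Labelling n col D φ τ hφ hτ
  1≤q : 1 ≤ q
  1≤q = ≤-trans 1≤p (<⇒≤ p<q)
  p≤2n : p ≤ 2 * n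
  p≤2n = ≤-trans (<⇒≤ p<q) q≤2n

  inversion⇒τ-reversed : IsInversion col p q → τ q < τ p
  inversion⇒τ-reversed (inj₁ (_ , q<p))   = contradiction q<p (<-asym p<q)
  inversion⇒τ-reversed (inj₂ (cq<cp , _)) = τ-column-monotone p q 1≤p p≤2n 1≤q q≤2n cq<cp

  τ-reversed⇒inversion : τ q < τ p → IsInversion col p q
  τ-reversed⇒inversion τq<τp with <-cmp (col q) (col p)
  ... | tri< cq<cp _ _ = inj₂ (cq<cp , p<q)
  ... | tri≈ _ cq≡cp _ = contradiction (τ-within-column p q 1≤p p≤2n 1≤q q≤2n p<q (sym cq≡cp)) (<-asym τq<τp)
  ... | tri> _ _ cp<cq = contradiction (τ-column-monotone q p 1≤q q≤2n 1≤p p≤2n cp<cq) (<-asym τq<τp)
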